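{- For all formulas $A, B$ of $L$ and every truth value assignment $V$ with $V(A)=F$: $$(\Delta[V;A])^{\sim A} \vdash (\Delta[V;A \& B])^{\sim(A \& B)} \quad\text{and}\quad (\Delta[V;A])^{\sim A} \vdash (\Delta[V;B \& A])^{\sim(B \& A)}.$$
   Context: **Language.** $L$ is the propositional language whose formulas are built from the atomic formulas $p_1, p_2, \dots$ using the binary connectives $\to$, $\vee$ and $\&$. Iterated connectives associate to the right. All formulas are arranged in a fixed decidable linear order $R$. **Semantics.** A truth value assignment $V$ maps formulas to $\{T,F\}$ according to the classical truth conditions. **Notation.** - $\Delta[V;A]$ is the set of atomic subformulas $C$ of $A$ with $V(C)=F$. - For a finite set $K$ of formulas with distinct elements $B_1, \dots, B_n$ listed in the order $R$, $(K)^{\sim A}$ is $A$ if $K$ is empty, and $A \to (B_1 \vee \dots \vee B_n)$ otherwise. Here $B_1 \vee \dots \vee B_n$ is right-associated, and is $B_1$ when $n=1$. **Calculus.** $\vdash$ denotes derivability in the classical positive propositional calculus. Its axiom schemes are: - $A \to B \to A$; - $(A \to B \to C) \to (A \to B) \to A \to C$; - $((A \to B) \to A) \to A$; - $A \to (A \vee B)$; - $A \to (B \vee A)$; - $(A \to C) \to (B \to C) \to (A \vee B) \to C$; - $(A \& B) \to A$; - $(A \& B) \to B$; - $A \to B \to (A \& B)$. Its only rule is modus ponens. -}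

module Defs where

open import Data.Nat using (ℕ)
open import Data.Bool using (Bool; true; false; _∧_; _∨_; not)
open import Data.List using (List; []; _∷_)
open import Relation.Binary.PropositionalEquality using (_≡_)
open import Relation.Binary.Structures using (IsStrictTotalOrder)
open import Relation.Binary.Definitions using (Tri; tri<; tri≈; tri>)
open import Relation.Nullary using (Dec; yes; no)
open import Data.Empty using (⊥)

infixr 5 _⇒_
infixr 6 _∨ᶠ_
infixr 7 _&_
data Formula : Set where
  p    : ℕ → Formula
  _⇒_  : Formula → Formula → Formula
  _∨ᶠ_ : Formula → Formula → Formula
  _&_  : Formula → Formula → Formula

Assignment : Set
Assignment = ℕ → Bool

⟦_⟧ : Formula → Assignment → Bool
⟦ p n ⟧ V = V n
⟦ A ⇒ B ⟧ V = not (⟦ A ⟧ V) ∨ ⟦ B ⟧ V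
⟦ A ∨ᶠ B ⟧ V = ⟦ A ⟧ V ∨ ⟦ B ⟧ V
⟦ A & B ⟧ V = ⟦ A ⟧ V ∧ ⟦ B ⟧ V

-- Derivability in the classical positive propositional calculus
-- (from a single hypothesis Γ; only rule modus ponens).
data _⊢_ (Γ : Formula) : Formula → Set where
  hyp : Γ ⊢ Γ
  ax1 : ∀ {A B} → Γ ⊢ (A ⇒ B ⇒ A)
  ax2 : ∀ {A B C} → Γ ⊢ ((A ⇒ B ⇒ C) ⇒ (A ⇒ B) ⇒ A ⇒ C)
  ax3 : ∀ {A B} → Γ ⊢ (((A ⇒ B) ⇒ A) ⇒ A)
  ax4 : ∀ {A B} → Γ ⊢ (A ⇒ (A ∨ᶠ B))
  ax5 : ∀ {A B} → Γ ⊢ (A ⇒ (B ∨ᶠ A))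
  ax6 : ∀ {A B C} → Γ ⊢ ((A ⇒ C) ⇒ (B ⇒ C) ⇒ (A ∨ᶠ B) ⇒ C)
  ax7 : ∀ {A B} → Γ ⊢ ((A & B) ⇒ A)
  ax8 : ∀ {A B} → Γ ⊢ ((A & B) ⇒ B)
  ax9 : ∀ {A B} → Γ ⊢ (A ⇒ B ⇒ (A & B))
  mp  : ∀ {A B} → Γ ⊢ (A ⇒ B) → Γ ⊢ A → Γ ⊢ B

-- Everything below is relative to the fixed decidable linear order R
-- on formulas, given as a strict total order (w.r.t. ≡).
module WithOrder {_<R_ : Formula → Formula → Set}
                 (R : IsStrictTotalOrder _≡_ _<R_) where
  open IsStrictTotalOrder R using (compare)

  -- insert into a strictly R-increasing list, discarding duplicates
  insert : Formula → List Formula → List Formula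
  insert x [] = x ∷ []
  insert x (y ∷ ys) with compare x y
  ... | tri< _ _ _ = x ∷ y ∷ ys
  ... | tri≈ _ _ _ = y ∷ ys
  ... | tri> _ _ _ = y ∷ insert x ys

  merge : List Formula → List Formula → List Formula
  merge [] ys = ys
  merge (x ∷ xs) ys = insert x (merge xs ys)

  -- Δ[V;A]: the atomic subformulas C of A with V(C) = F,
  -- as a duplicate-free list in the order R
  Δ : Assignment → Formula → List Formula
  Δ V (p n) with V n
  ... | true  = []
  ... | false = p n ∷ []
  Δ V (A ⇒ B) = merge (Δ V A) (Δ V B)
  Δ V (A ∨ᶠ B) = merge (Δ V A) (Δ V B)
  Δ V (A & B) = merge (Δ V A) (Δ V B)

  bigOr : Formula → List Formula → Formula
  bigOr B [] = B
  bigOr B (C ∷ Cs) = B ∨ᶠ bigOr C Cs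

  tilde : List Formula → Formula → Formula
  tilde [] A = A
  tilde (B ∷ Bs) A = A ⇒ bigOr B Bs

-- Since V(A) = F, some atom of A is false (a formula all of whose atoms are true is true), so
-- Δ[V;A] is nonempty and the hypothesis is A → ⋁Δ[V;A].  Both Δ[V;A & B] and Δ[V;B & A]
-- contain Δ[V;A], so each goal follows by chaining A & B → A (resp. B & A → A), the
-- hypothesis, and the weakening ⋁Δ[V;A] → ⋁Δ[V;A & B] of one disjunction to a larger one.
module Submission where

open import Defs
open import Data.Bool using (true; false)
open import Data.List using (List; []; _∷_)
open import Data.List.Membership.Propositional using (_∈_)
open import Data.List.Relation.Binary.Subset.Propositional using (_⊆_)
open import Data.List.Relation.Binary.Subset.Propositional.Properties using (⊆[]⇒≡[]; ∷⊈[])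
open import Data.List.Relation.Unary.Any using (here; there)
open import Data.Product using (_×_; _,_)
open import Relation.Binary.Definitions using (tri<; tri≈; tri>)
open import Relation.Binary.PropositionalEquality using (_≡_; _≢_; refl; subst)
open import Relation.Binary.Structures using (IsStrictTotalOrder)

⊢-id : ∀ {Γ A} → Γ ⊢ (A ⇒ A)
⊢-id {A = A} = mp (mp ax2 ax1) (ax1 {B = A})

⊢-∘ : ∀ {Γ X Y Z} → Γ ⊢ (Y ⇒ Z) → Γ ⊢ (X ⇒ Y) → Γ ⊢ (X ⇒ Z)
⊢-∘ g f = mp (mp ax2 (mp ax1 g)) f

module _ {_<R_ : Formula → Formula → Set} (R : IsStrictTotalOrder _≡_ _<R_) where
  open IsStrictTotalOrder R using (compare)
  open WithOrder R

  ⊢-bigOr-intro : ∀ {Γ x} C Cs → x ∈ C ∷ Cs → Γ ⊢ (x ⇒ bigOr C Cs)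
  ⊢-bigOr-intro C []       (here refl) = ⊢-id
  ⊢-bigOr-intro C (D ∷ Ds) (here refl) = ax4
  ⊢-bigOr-intro C (D ∷ Ds) (there x∈) = ⊢-∘ ax5 (⊢-bigOr-intro D Ds x∈)

  ⊢-bigOr-elim : ∀ {Γ T} C Cs → (∀ {x} → x ∈ C ∷ Cs → Γ ⊢ (x ⇒ T)) → Γ ⊢ (bigOr C Cs ⇒ T)
  ⊢-bigOr-elim C []       f = f (here refl)
  ⊢-bigOr-elim C (D ∷ Ds) f = mp (mp ax6 (f (here refl))) (⊢-bigOr-elim D Ds (λ x∈ → f (there x∈)))

  ⊢-bigOr-⊆ : ∀ {Γ} C Cs D Ds → C ∷ Cs ⊆ D ∷ Ds → Γ ⊢ (bigOr C Cs ⇒ bigOr D Ds)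
  ⊢-bigOr-⊆ C Cs D Ds sub = ⊢-bigOr-elim C Cs (λ x∈ → ⊢-bigOr-intro D Ds (sub x∈))

  tilde-⊆ : ∀ {K L A X} → K ≢ [] → K ⊆ L → tilde K A ⊢ (X ⇒ A) → tilde K A ⊢ tilde L X
  tilde-⊆ {[]}     K≢[] _ _ with () ← K≢[] refl
  tilde-⊆ {C ∷ Cs} {[]} _ sub _ with () ← ∷⊈[] sub
  tilde-⊆ {C ∷ Cs} {D ∷ Ds} _ sub X⇒A = ⊢-∘ (⊢-∘ (⊢-bigOr-⊆ C Cs D Ds sub) hyp) X⇒A

  ∈-insert : ∀ x ys → x ∈ insert x ys
  ∈-insert x []       = here refl
  ∈-insert x (y ∷ ys) with compare x y
  ... | tri< _ _   _ = here refl
  ... | tri≈ _ x≡y _ = here x≡y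
  ... | tri> _ _   _ = there (∈-insert x ys)

  ⊆-insert : ∀ x ys → ys ⊆ insert x ys
  ⊆-insert x (y ∷ ys) y∈ with compare x y | y∈
  ... | tri< _ _ _ | _         = there y∈
  ... | tri≈ _ _ _ | _         = y∈
  ... | tri> _ _ _ | here z≡y  = here z≡y
  ... | tri> _ _ _ | there z∈  = there (⊆-insert x ys z∈)

  ⊆-mergeˡ : ∀ xs ys → xs ⊆ merge xs ys
  ⊆-mergeˡ (x ∷ xs) ys (here refl) = ∈-insert x (merge xs ys)
  ⊆-mergeˡ (x ∷ xs) ys (there z∈)  = ⊆-insert x (merge xs ys) (⊆-mergeˡ xs ys z∈)

  ⊆-mergeʳ : ∀ xs ys → ys ⊆ merge xs ys
  ⊆-mergeʳ []       ys z∈ = z∈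
  ⊆-mergeʳ (x ∷ xs) ys z∈ = ⊆-insert x (merge xs ys) (⊆-mergeʳ xs ys z∈)

  merge≡[]ˡ : ∀ xs ys → merge xs ys ≡ [] → xs ≡ []
  merge≡[]ˡ xs ys eq = ⊆[]⇒≡[] (subst (xs ⊆_) eq (⊆-mergeˡ xs ys))

  merge≡[]ʳ : ∀ xs ys → merge xs ys ≡ [] → ys ≡ []
  merge≡[]ʳ xs ys eq = ⊆[]⇒≡[] (subst (ys ⊆_) eq (⊆-mergeʳ xs ys))

  Δ≡[]⇒⟦⟧≡true : ∀ V A → Δ V A ≡ [] → ⟦ A ⟧ V ≡ true
  Δ≡[]⇒⟦⟧≡true V (p n) eq with V n | eq
  ... | true | _ = refl
  Δ≡[]⇒⟦⟧≡true V (A ⇒ B) eq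
    rewrite Δ≡[]⇒⟦⟧≡true V B (merge≡[]ʳ (Δ V A) (Δ V B) eq) with ⟦ A ⟧ V
  ... | true  = refl
  ... | false = refl
  Δ≡[]⇒⟦⟧≡true V (A ∨ᶠ B) eq
    rewrite Δ≡[]⇒⟦⟧≡true V A (merge≡[]ˡ (Δ V A) (Δ V B) eq) = refl
  Δ≡[]⇒⟦⟧≡true V (A & B) eq
    rewrite Δ≡[]⇒⟦⟧≡true V A (merge≡[]ˡ (Δ V A) (Δ V B) eq)
          | Δ≡[]⇒⟦⟧≡true V B (merge≡[]ʳ (Δ V A) (Δ V B) eq) = refl

  ⟦⟧≡false⇒Δ≢[] : ∀ V A → ⟦ A ⟧ V ≡ false → Δ V A ≢ []
  ⟦⟧≡false⇒Δ≢[] V A A≡false eq with () ← subst (_≡ false) (Δ≡[]⇒⟦⟧≡true V A eq) A≡false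

mainTheorem18 : {_<R_ : Formula → Formula → Set}
    (R : IsStrictTotalOrder _≡_ _<R_) →
    (A B : Formula) (V : Assignment) → ⟦ A ⟧ V ≡ false →
    (WithOrder.tilde R (WithOrder.Δ R V A) A ⊢ WithOrder.tilde R (WithOrder.Δ R V (A & B)) (A & B))
    × (WithOrder.tilde R (WithOrder.Δ R V A) A ⊢ WithOrder.tilde R (WithOrder.Δ R V (B & A)) (B & A))
mainTheorem18 R A B V A≡false =
  tilde-⊆ R Δ≢[] (⊆-mergeˡ R (Δ V A) (Δ V B)) ax7 ,
  tilde-⊆ R Δ≢[] (⊆-mergeʳ R (Δ V B) (Δ V A)) ax8
  where
    open WithOrder R using (Δ)
    Δ≢[] : Δ V A ≢ []
    Δ≢[] = ⟦⟧≡false⇒Δ≢[] R V A A≡false
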